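{- Let $\mathcal{M}=\langle M,\in^{\mathcal{M}}\rangle$ be a model of $\mathrm{BAS}$. Then $\langle M,\subseteq^{\mathcal{M}}\rangle$ is a model of $\mathrm{Mer}$ whose set of atoms has the same cardinality as $M$.
   Context: $\mathcal{L}$ is the first-order language with one binary relation $\in$. $\mathrm{BAS}$ is the $\mathcal{L}$-theory with axioms: (Emp) $\exists x\forall y(y\notin x)$; (Adj) $\forall x\forall y\exists z\forall u(u\in z\iff(u\in x\lor u=y))$; (Ext) $\forall x\forall y(x=y\iff\forall z(z\in x\iff z\in y))$; (Union) $\forall x\forall y\exists z\forall u(u\in z\iff u\in x\lor u\in y)$; (Intersection) $\forall x\forall y\exists z\forall u(u\in z\iff u\in x\land u\in y)$; (RelComp) $\forall x\forall y\exists z\forall u(u\in z\iff u\in x\land u\notin y)$; (UB) $\forall x\exists y(y\notin x)$. For an $\mathcal{L}$-structure $\mathcal{M}=\langle M,\in^{\mathcal{M}}\rangle$, $\subseteq^{\mathcal{M}}$ is the relation on $M$ given by $a\subseteq^{\mathcal{M}}b$ iff for all $c\in M$, $c\in^{\mathcal{M}}a$ implies $c\in^{\mathcal{M}}b$. $\mathrm{Mer}$ is the theory, in the language with one binary relation $\sqsubseteq$, of atomic unbounded relatively complemented distributive lattices: $\sqsubseteq$ is a partial order with a least element $0$ in which any two elements $x,y$ have a least upper bound $x\dot\lor y$ and a greatest lower bound $x\dot\land y$; (Atomic) every nonzero element has an atom below it, where an atom is a nonzero $a$ such that $y\sqsubseteq a$ implies $y=0$ or $y=a$; (Unbounded) every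 $x$ has some $y\ne x$ with $x\sqsubseteq y$; (Relatively complemented) for all $x,y$ there is $z$ with $y\dot\land z=0$ and $x=(x\dot\land y)\dot\lor z$; (Distributive) $x\dot\land(y\dot\lor z)=(x\dot\land y)\dot\lor(x\dot\land z)$ and $x\dot\lor(y\dot\land z)=(x\dot\lor y)\dot\land(x\dot\lor z)$ for all $x,y,z$. -}

module Defs where

open import Data.Product using (Σ; ∃; _×_; _,_; proj₁)
open import Data.Sum using (_⊎_)
open import Relation.Nullary using (¬_)
open import Relation.Binary.PropositionalEquality using (_≡_; _≢_)
open import Function.Definitions using (Injective)

record BAS (M : Set) (_∈_ : M → M → Set) : Set where
  field
    emp          : Σ M λ x → ∀ y → ¬ (y ∈ x)
    adj          : ∀ x y → Σ M λ z → ∀ u → ((u ∈ z → (u ∈ x) ⊎ (u ≡ y)) × ((u ∈ x) ⊎ (u ≡ y) → u ∈ z))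
    ext          : ∀ x y → ((x ≡ y → ∀ z → ((z ∈ x → z ∈ y) × (z ∈ y → z ∈ x)))
                          × ((∀ z → ((z ∈ x → z ∈ y) × (z ∈ y → z ∈ x))) → x ≡ y))
    union        : ∀ x y → Σ M λ z → ∀ u → ((u ∈ z → (u ∈ x) ⊎ (u ∈ y)) × ((u ∈ x) ⊎ (u ∈ y) → u ∈ z))
    intersection : ∀ x y → Σ M λ z → ∀ u → ((u ∈ z → (u ∈ x) × (u ∈ y)) × ((u ∈ x) × (u ∈ y) → u ∈ z))
    relComp      : ∀ x y → Σ M λ z → ∀ u → ((u ∈ z → (u ∈ x) × ¬ (u ∈ y)) × ((u ∈ x) × ¬ (u ∈ y) → u ∈ z))
    ub           : ∀ x → Σ M λ y → ¬ (y ∈ x)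

_⊆[_]_ : {M : Set} → M → (M → M → Set) → M → Set
_⊆[_]_ {M} a _∈_ b = ∀ (c : M) → c ∈ a → c ∈ b

module Order {M : Set} (_⊑_ : M → M → Set) where

  IsLeast : M → Set
  IsLeast z = ∀ x → z ⊑ x

  IsLUB : M → M → M → Set
  IsLUB x y s = (x ⊑ s) × (y ⊑ s) × (∀ w → x ⊑ w → y ⊑ w → s ⊑ w)

  IsGLB : M → M → M → Set
  IsGLB x y m = (m ⊑ x) × (m ⊑ y) × (∀ w → w ⊑ x → w ⊑ y → w ⊑ m)

-- ⟨M, ⊑⟩ is a model of Mer: an atomic unbounded relatively complemented
-- distributive lattice with least element 0.  The least element, the
-- joins and the meets are given by their (unique) witnesses; the
-- lattice operations x ∨̇ y, x ∧̇ y used in the later axioms are the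
-- witnessed least upper bounds / greatest lower bounds.
record Mer {M : Set} (_⊑_ : M → M → Set) : Set where
  open Order _⊑_
  field
    refl⊑    : ∀ x → x ⊑ x
    trans⊑   : ∀ x y z → x ⊑ y → y ⊑ z → x ⊑ z
    antisym⊑ : ∀ x y → x ⊑ y → y ⊑ x → x ≡ y
    bottom   : Σ M IsLeast
    join     : ∀ x y → Σ M (IsLUB x y)
    meet     : ∀ x y → Σ M (IsGLB x y)

  𝟘 : M
  𝟘 = proj₁ bottom

  _∨̇_ : M → M → M
  x ∨̇ y = proj₁ (join x y)

  _∧̇_ : M → M → M
  x ∧̇ y = proj₁ (meet x y)

  IsAtom : M → Set
  IsAtom a = (a ≢ 𝟘) × (∀ y → y ⊑ a → (y ≡ 𝟘) ⊎ (y ≡ a))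

  field
    atomic      : ∀ x → x ≢ 𝟘 → Σ M λ a → IsAtom a × (a ⊑ x)
    unbounded   : ∀ x → Σ M λ y → (y ≢ x) × (x ⊑ y)
    relCompl    : ∀ x y → Σ M λ z → ((y ∧̇ z) ≡ 𝟘) × (x ≡ ((x ∧̇ y) ∨̇ z))
    distrib-∧∨  : ∀ x y z → (x ∧̇ (y ∨̇ z)) ≡ ((x ∧̇ y) ∨̇ (x ∧̇ z))
    distrib-∨∧  : ∀ x y z → (x ∨̇ (y ∧̇ z)) ≡ ((x ∨̇ y) ∧̇ (x ∨̇ z))

-- "The set of atoms has the same cardinality as M": there is a bijection
-- between M and the subset of atoms, i.e. an injective f : M → M whose
-- image is exactly the set of atoms.
SameCardAsAtoms : {M : Set} {_⊑_ : M → M → Set} → Mer _⊑_ → Set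
SameCardAsAtoms {M} mer =
  Σ (M → M) λ f → ((∀ x → IsAtom (f x)) × Injective _≡_ _≡_ f
                   × (∀ a → IsAtom a → Σ M λ x → f x ≡ a))
  where open Mer mer

-- Since ⊆ is extensional, ⟨M, ⊆⟩ is a partial order with least element ∅, in
-- which union, intersection and relative complement are join, meet and relative
-- complement, so the lattice laws reduce to propositional logic on membership.
-- Adjoining an element outside x gives a proper superset of x.  The atoms are
-- exactly the singletons: a nonempty set has an element u (classically), and
-- ｛ u ｝ lies below it.  Hence x ↦ ｛ x ｝ is a bijection from M onto the atoms.
module Submission where

open import Defs
open import Data.Empty using (⊥-elim)
open import Data.Product using (Σ; _×_; _,_; proj₁; proj₂)
open import Data.Sum using (_⊎_; inj₁; inj₂; [_,_])
import Data.Sum as Sum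
open import Function.Base using (_∘_)
open import Function.Definitions using (Injective)
open import Relation.Nullary using (¬_; yes; no)
open import Relation.Binary.PropositionalEquality using (_≡_; _≢_; refl; sym; subst)
open import Axiom.ExcludedMiddle using (ExcludedMiddle)
open import Level using (0ℓ)

module BASProperties {M : Set} {_∈_ : M → M → Set} (bas : BAS M _∈_) where
  open BAS bas
  open Order

  infix 4 _⊆_
  _⊆_ : M → M → Set
  a ⊆ b = a ⊆[ _∈_ ] b

  ⊆-refl : ∀ {a} → a ⊆ a
  ⊆-refl _ u∈a = u∈a

  ⊆-trans : ∀ {a b c} → a ⊆ b → b ⊆ c → a ⊆ c
  ⊆-trans a⊆b b⊆c u u∈a = b⊆c u (a⊆b u u∈a)

  ⊆-antisym : ∀ {a b} → a ⊆ b → b ⊆ a → a ≡ b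
  ⊆-antisym {a} {b} a⊆b b⊆a = proj₂ (ext a b) (λ u → a⊆b u , b⊆a u)

  ∈-resp-≡ : ∀ {u v a} → u ≡ v → u ∈ a → v ∈ a
  ∈-resp-≡ {a = a} = subst (_∈ a)

  ∈-cong : ∀ {u a b} → a ≡ b → u ∈ a → u ∈ b
  ∈-cong {u} = subst (u ∈_)

  ∅ : M
  ∅ = proj₁ emp

  ∉∅ : ∀ u → ¬ (u ∈ ∅)
  ∉∅ = proj₂ emp

  ∅-least : IsLeast _⊆_ ∅
  ∅-least _ u u∈∅ = ⊥-elim (∉∅ u u∈∅)

  empty⇒≡∅ : ∀ {a} → (∀ u → ¬ (u ∈ a)) → a ≡ ∅
  empty⇒≡∅ empty = ⊆-antisym (λ u u∈a → ⊥-elim (empty u u∈a)) (∅-least _)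

  insert : M → M → M
  insert y x = proj₁ (adj x y)

  ∈-insert⁻ : ∀ {x y u} → u ∈ insert y x → u ∈ x ⊎ u ≡ y
  ∈-insert⁻ {x} {y} {u} = proj₁ (proj₂ (adj x y) u)

  ∈-insert : ∀ {x y} → y ∈ insert y x
  ∈-insert {x} {y} = proj₂ (proj₂ (adj x y) y) (inj₂ refl)

  ⊆-insert : ∀ {x y} → x ⊆ insert y x
  ⊆-insert {x} {y} u u∈x = proj₂ (proj₂ (adj x y) u) (inj₁ u∈x)

  ⊆-unbounded : ∀ x → Σ M λ y → (y ≢ x) × (x ⊆ y)
  ⊆-unbounded x with ub x
  ... | y , y∉x = insert y x , (λ y⁺≡x → y∉x (∈-cong y⁺≡x ∈-insert)) , ⊆-insert

  ｛_｝ : M → M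
  ｛ x ｝ = insert x ∅

  ∈-｛｝ : ∀ {x} → x ∈ ｛ x ｝
  ∈-｛｝ = ∈-insert

  ∈-｛｝⁻ : ∀ {x u} → u ∈ ｛ x ｝ → u ≡ x
  ∈-｛｝⁻ {u = u} u∈｛x｝ = [ (λ u∈∅ → ⊥-elim (∉∅ u u∈∅)) , (λ u≡x → u≡x) ] (∈-insert⁻ u∈｛x｝)

  ｛｝-⊆ : ∀ {x a} → x ∈ a → ｛ x ｝ ⊆ a
  ｛｝-⊆ x∈a u u∈｛x｝ = ∈-resp-≡ (sym (∈-｛｝⁻ u∈｛x｝)) x∈a

  ｛｝≢∅ : ∀ x → ｛ x ｝ ≢ ∅
  ｛｝≢∅ x ｛x｝≡∅ = ∉∅ x (∈-cong ｛x｝≡∅ ∈-｛｝)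

  ｛｝-injective : Injective _≡_ _≡_ ｛_｝
  ｛｝-injective ｛x｝≡｛y｝ = ∈-｛｝⁻ (∈-cong ｛x｝≡｛y｝ ∈-｛｝)

  infixl 6 _∪_ _∖_
  infixl 7 _∩_
  _∪_ _∩_ _∖_ : M → M → M
  x ∪ y = proj₁ (union x y)
  x ∩ y = proj₁ (intersection x y)
  x ∖ y = proj₁ (relComp x y)

  ∈-∪⁻ : ∀ {x y u} → u ∈ (x ∪ y) → u ∈ x ⊎ u ∈ y
  ∈-∪⁻ {x} {y} {u} = proj₁ (proj₂ (union x y) u)

  ∈-∪⁺ : ∀ {x y u} → u ∈ x ⊎ u ∈ y → u ∈ (x ∪ y)
  ∈-∪⁺ {x} {y} {u} = proj₂ (proj₂ (union x y) u)

  ∈-∩⁻ : ∀ {x y u} → u ∈ (x ∩ y) → u ∈ x × u ∈ y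
  ∈-∩⁻ {x} {y} {u} = proj₁ (proj₂ (intersection x y) u)

  ∈-∩⁺ : ∀ {x y u} → u ∈ x × u ∈ y → u ∈ (x ∩ y)
  ∈-∩⁺ {x} {y} {u} = proj₂ (proj₂ (intersection x y) u)

  ∈-∖⁻ : ∀ {x y u} → u ∈ (x ∖ y) → u ∈ x × ¬ (u ∈ y)
  ∈-∖⁻ {x} {y} {u} = proj₁ (proj₂ (relComp x y) u)

  ∈-∖⁺ : ∀ {x y u} → u ∈ x × ¬ (u ∈ y) → u ∈ (x ∖ y)
  ∈-∖⁺ {x} {y} {u} = proj₂ (proj₂ (relComp x y) u)

  ∪-isLUB : ∀ x y → IsLUB _⊆_ x y (x ∪ y)
  ∪-isLUB x y =
    (λ _ → ∈-∪⁺ ∘ inj₁) , (λ _ → ∈-∪⁺ ∘ inj₂) ,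
    (λ w x⊆w y⊆w u u∈x∪y → [ x⊆w u , y⊆w u ] (∈-∪⁻ u∈x∪y))

  ∩-isGLB : ∀ x y → IsGLB _⊆_ x y (x ∩ y)
  ∩-isGLB x y =
    (λ _ u∈x∩y → proj₁ (∈-∩⁻ u∈x∩y)) , (λ _ u∈x∩y → proj₂ (∈-∩⁻ u∈x∩y)) ,
    (λ w w⊆x w⊆y u u∈w → ∈-∩⁺ (w⊆x u u∈w , w⊆y u u∈w))

  ∩-distribˡ-∪ : ∀ x y z → x ∩ (y ∪ z) ≡ (x ∩ y) ∪ (x ∩ z)
  ∩-distribˡ-∪ x y z = ⊆-antisym to from
    where
    to : x ∩ (y ∪ z) ⊆ (x ∩ y) ∪ (x ∩ z)
    to u u∈lhs with ∈-∩⁻ u∈lhs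
    ... | u∈x , u∈y∪z = ∈-∪⁺ (Sum.map (λ u∈y → ∈-∩⁺ (u∈x , u∈y)) (λ u∈z → ∈-∩⁺ (u∈x , u∈z)) (∈-∪⁻ u∈y∪z))
    from : (x ∩ y) ∪ (x ∩ z) ⊆ x ∩ (y ∪ z)
    from u u∈rhs with ∈-∪⁻ u∈rhs
    ... | inj₁ u∈x∩y = let u∈x , u∈y = ∈-∩⁻ u∈x∩y in ∈-∩⁺ (u∈x , ∈-∪⁺ (inj₁ u∈y))
    ... | inj₂ u∈x∩z = let u∈x , u∈z = ∈-∩⁻ u∈x∩z in ∈-∩⁺ (u∈x , ∈-∪⁺ (inj₂ u∈z))

  ∪-distribˡ-∩ : ∀ x y z → x ∪ (y ∩ z) ≡ (x ∪ y) ∩ (x ∪ z)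
  ∪-distribˡ-∩ x y z = ⊆-antisym to from
    where
    to : x ∪ (y ∩ z) ⊆ (x ∪ y) ∩ (x ∪ z)
    to u u∈lhs with ∈-∪⁻ u∈lhs
    ... | inj₁ u∈x   = ∈-∩⁺ (∈-∪⁺ (inj₁ u∈x) , ∈-∪⁺ (inj₁ u∈x))
    ... | inj₂ u∈y∩z = let u∈y , u∈z = ∈-∩⁻ u∈y∩z in ∈-∩⁺ (∈-∪⁺ (inj₂ u∈y) , ∈-∪⁺ (inj₂ u∈z))
    from : (x ∪ y) ∩ (x ∪ z) ⊆ x ∪ (y ∩ z)
    from u u∈rhs with ∈-∩⁻ u∈rhs
    ... | u∈x∪y , u∈x∪z with ∈-∪⁻ u∈x∪y | ∈-∪⁻ u∈x∪z
    ... | inj₁ u∈x | _        = ∈-∪⁺ (inj₁ u∈x)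
    ... | inj₂ _   | inj₁ u∈x = ∈-∪⁺ (inj₁ u∈x)
    ... | inj₂ u∈y | inj₂ u∈z = ∈-∪⁺ (inj₂ (∈-∩⁺ (u∈y , u∈z)))

  ∩-∖-disjoint : ∀ x y → y ∩ (x ∖ y) ≡ ∅
  ∩-∖-disjoint x y = empty⇒≡∅ λ u u∈y∩x∖y →
    let u∈y , u∈x∖y = ∈-∩⁻ u∈y∩x∖y in proj₂ (∈-∖⁻ u∈x∖y) u∈y

  IsAtom : M → Set
  IsAtom a = (a ≢ ∅) × (∀ y → y ⊆ a → y ≡ ∅ ⊎ y ≡ a)

  module Classical (em : ExcludedMiddle 0ℓ) where

    ≢∅⇒nonempty : ∀ {a} → a ≢ ∅ → Σ M (_∈ a)
    ≢∅⇒nonempty {a} a≢∅ with em {Σ M (_∈ a)}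
    ... | yes nonempty = nonempty
    ... | no  empty    = ⊥-elim (a≢∅ (empty⇒≡∅ λ u u∈a → empty (u , u∈a)))

    ∩-∪-∖-split : ∀ x y → x ≡ (x ∩ y) ∪ (x ∖ y)
    ∩-∪-∖-split x y = ⊆-antisym to from
      where
      to : x ⊆ (x ∩ y) ∪ (x ∖ y)
      to u u∈x with em {u ∈ y}
      ... | yes u∈y = ∈-∪⁺ (inj₁ (∈-∩⁺ (u∈x , u∈y)))
      ... | no  u∉y = ∈-∪⁺ (inj₂ (∈-∖⁺ (u∈x , u∉y)))
      from : (x ∩ y) ∪ (x ∖ y) ⊆ x
      from u = [ proj₁ ∘ ∈-∩⁻ , proj₁ ∘ ∈-∖⁻ ] ∘ ∈-∪⁻

    ｛｝-isAtom : ∀ x → IsAtom ｛ x ｝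
    ｛｝-isAtom x = ｛｝≢∅ x , below
      where
      below : ∀ y → y ⊆ ｛ x ｝ → y ≡ ∅ ⊎ y ≡ ｛ x ｝
      below y y⊆｛x｝ with em {x ∈ y}
      ... | yes x∈y = inj₂ (⊆-antisym y⊆｛x｝ (｛｝-⊆ x∈y))
      ... | no  x∉y = inj₁ (empty⇒≡∅ λ u u∈y → x∉y (∈-resp-≡ (∈-｛｝⁻ (y⊆｛x｝ u u∈y)) u∈y))

    atom⇒｛｝ : ∀ a → IsAtom a → Σ M λ u → ｛ u ｝ ≡ a
    atom⇒｛｝ a (a≢∅ , minimal) with ≢∅⇒nonempty a≢∅
    ... | u , u∈a with minimal ｛ u ｝ (｛｝-⊆ u∈a)
    ...   | inj₁ ｛u｝≡∅ = ⊥-elim (｛｝≢∅ u ｛u｝≡∅)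
    ...   | inj₂ ｛u｝≡a = u , ｛u｝≡a

    atomic : ∀ x → x ≢ ∅ → Σ M λ a → IsAtom a × a ⊆ x
    atomic x x≢∅ with ≢∅⇒nonempty x≢∅
    ... | u , u∈x = ｛ u ｝ , ｛｝-isAtom u , ｛｝-⊆ u∈x

    ⊆-isMer : Mer _⊆_
    ⊆-isMer = record
      { refl⊑      = λ _ → ⊆-refl
      ; trans⊑     = λ _ _ _ → ⊆-trans
      ; antisym⊑   = λ _ _ → ⊆-antisym
      ; bottom     = ∅ , ∅-least
      ; join       = λ x y → x ∪ y , ∪-isLUB x y
      ; meet       = λ x y → x ∩ y , ∩-isGLB x y
      ; atomic     = atomic
      ; unbounded  = ⊆-unbounded
      ; relCompl   = λ x y → x ∖ y , ∩-∖-disjoint x y , ∩-∪-∖-split x y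
      ; distrib-∧∨ = ∩-distribˡ-∪
      ; distrib-∨∧ = ∪-distribˡ-∩
      }

mainTheorem1 : ExcludedMiddle 0ℓ → (M : Set) (_∈_ : M → M → Set) → BAS M _∈_ →
    Σ (Mer (λ a b → a ⊆[ _∈_ ] b)) SameCardAsAtoms
mainTheorem1 em M _∈_ bas = ⊆-isMer , ｛_｝ , ｛｝-isAtom , ｛｝-injective , atom⇒｛｝
  where
  open BASProperties bas
  open Classical em
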